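{- For non-empty finite or cofinite sets $\sigma,\rho\subseteq\mathbb{Z}_{\ge0}$, there is a $\{\rho_0,\rho_1,\dots,\rho_{r_{\mathrm{top}}}\}$-provider (with a single portal).
   Context: $r_{\mathrm{top}}=\max\rho$ if $\rho$ is finite and $r_{\mathrm{top}}=\max(\mathbb{Z}_{\ge0}\setminus\rho)+1$ if $\rho$ is cofinite ($0$ if $\rho=\mathbb{Z}_{\ge0}$). For a graph $G$ and a set of portals $U\subseteq V(G)$, a partial solution is $S\subseteq V(G)$ with $|N(v)\cap S|\in\rho$ for all $v\in V(G)\setminus(S\cup U)$ and $|N(v)\cap S|\in\sigma$ for all $v\in S\setminus U$. A string $x$ over symbols $\{\sigma_i,\rho_i:i\ge0\}$ indexed by $U$ is compatible with $(G,U)$ if some partial solution $S$ satisfies, for each $v\in U$, $x[v]=\sigma_{|N(v)\cap S|}$ if $v\in S$ and $x[v]=\rho_{|N(v)\cap S|}$ if $v\notin S$. $(G,U)$ is an $L$-provider if every string of $L$ is compatible with $(G,U)$. -}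

module Defs where

open import Data.Nat using (ℕ; zero; suc; _⊔_; _≤_)
open import Data.List using (List; []; _∷_; foldr; filter; length; allFin)
open import Data.List.Membership.Propositional using (_∈_; _∉_)
open import Data.Bool using (Bool; true; false; T; _∧_)
open import Data.Bool.Properties renaming (_≟_ to _≟B_)
open import Data.Fin using (Fin) renaming (_≟_ to _≟F_)
open import Relation.Nullary.Decidable.Core using (⌊_⌋)
open import Data.Product using (Σ; _×_; _,_; ∃)
open import Relation.Binary.PropositionalEquality using (_≡_; _≢_)
open import Relation.Nullary using (¬_)
open import Data.Empty using (⊥)

-- A finite or cofinite subset of ℕ.
--   fin l   : the set of elements of l
--   cofin l : the set ℕ ∖ (elements of l)
data FinCof : Set where
  fin   : List ℕ → FinCof
  cofin : List ℕ → FinCof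

_∈S_ : ℕ → FinCof → Set
n ∈S fin l   = n ∈ l
n ∈S cofin l = n ∉ l

NonEmpty : FinCof → Set
NonEmpty A = ∃ λ n → n ∈S A

maxL : List ℕ → ℕ
maxL = foldr _⊔_ 0

rtop : FinCof → ℕ
rtop (fin l)        = maxL l
rtop (cofin [])     = 0
rtop (cofin (x ∷ l)) = suc (maxL (x ∷ l))

record Graph (n : ℕ) : Set where
  field
    adj   : Fin n → Fin n → Bool
    sym   : ∀ u v → adj u v ≡ adj v u
    irrefl : ∀ v → adj v v ≡ false
open Graph public

VSet : ℕ → Set
VSet n = Fin n → Bool

degIn : {n : ℕ} → Graph n → VSet n → Fin n → ℕ
degIn G S v = length (filter (λ w → (adj G v w ∧ S w) ≟B true) (allFin _))

IsPartialSolution : FinCof → FinCof → {n : ℕ} → Graph n → VSet n → VSet n → Set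
IsPartialSolution σ ρ G U S =
  ∀ v → ¬ T (U v) →
    (¬ T (S v) → degIn G S v ∈S ρ) × (T (S v) → degIn G S v ∈S σ)

data Symbol : Set where
  σ′ : ℕ → Symbol
  ρ′ : ℕ → Symbol

stateOf : {n : ℕ} → Graph n → VSet n → Fin n → Symbol
stateOf G S v with S v
... | true  = σ′ (degIn G S v)
... | false = ρ′ (degIn G S v)

-- strings indexed by U are represented as functions on all of Fin n;
-- only the values on U matter.
Compatible : FinCof → FinCof → {n : ℕ} → Graph n → VSet n → (Fin n → Symbol) → Set
Compatible σ ρ G U x =
  ∃ λ S → IsPartialSolution σ ρ G U S × (∀ v → T (U v) → x v ≡ stateOf G S v)

IsProvider : FinCof → FinCof → {n : ℕ} → Graph n → VSet n → ((Fin n → Symbol) → Set) → Set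
IsProvider σ ρ G U L = ∀ x → L x → Compatible σ ρ G U x

single : {n : ℕ} → Fin n → VSet n
single u v = ⌊ u ≟F v ⌋

RhoUpTo : {n : ℕ} → Fin n → ℕ → (Fin n → Symbol) → Set
RhoUpTo u r x = ∃ λ i → i ≤ r × x u ≡ ρ′ i

-- The gadget consists of two classes, each a grid of (s+1)(p+1) cells (a, k): within a
-- class, cells in the same column k are adjacent; across the classes, cells in the same
-- row a but different columns are adjacent. Selecting either class, every selected vertex
-- has exactly s selected neighbours and every other vertex exactly p. Take r = r_top
-- disjoint gadgets and a portal joined to one class-0 vertex of each; selecting class 0 in
-- i of the gadgets and class 1 in the others is a partial solution in which the portal
-- is in state ρ_i.
{-# OPTIONS --safe #-}
module Submission where

open import Defs hiding (sym)
open import Data.Bool using (Bool; true; false; T; _∧_; not; if_then_else_)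
open import Data.Bool.Properties using (∧-zeroʳ; ∧-identityʳ) renaming (_≟_ to _≟B_)
open import Data.Empty using (⊥-elim)
open import Data.Fin using (Fin; zero; suc; toℕ; punchIn; combine; quotient; remainder; _↑ˡ_; _↑ʳ_)
  renaming (_≟_ to _≟F_)
open import Data.Fin.Properties using (remQuot-combine; punchInᵢ≢i)
open import Data.List using (filter; length; tabulate)
open import Data.Nat using (ℕ; zero; suc; _+_; _*_; _≤_; s≤s; _<ᵇ_)
open import Data.Nat.Properties using (+-0-commutativeMonoid; +-assoc; +-identityʳ)
open import Algebra.Properties.CommutativeMonoid.Sum +-0-commutativeMonoid
  using (sum; sum-syntax; sum-cong-≗; sum-remove; sum-replicate-zero)
open import Data.Product using (Σ; ∃; _×_; _,_; proj₁; proj₂; uncurry)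
open import Data.Unit using (tt)
open import Data.Vec.Functional using (_∷_)
open import Function using (_∘_)
open import Relation.Binary.PropositionalEquality
open import Relation.Nullary using (¬_; yes; no)
open import Relation.Nullary.Decidable using (⌊_⌋; toWitness; fromWitness)

infix 4 _==_

_==_ : ∀ {n} → Fin n → Fin n → Bool
x == y = ⌊ x ≟F y ⌋

==-refl : ∀ {n} (x : Fin n) → (x == x) ≡ true
==-refl x with x ≟F x
... | yes _   = refl
... | no x≢x = ⊥-elim (x≢x refl)

≢⇒==-false : ∀ {n} {x y : Fin n} → x ≢ y → (x == y) ≡ false
≢⇒==-false {x = x} {y} x≢y with x ≟F y
... | yes x≡y = ⊥-elim (x≢y x≡y)
... | no _    = refl

==-sym : ∀ {n} (x y : Fin n) → (x == y) ≡ (y == x)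
==-sym x y with x ≟F y | y ≟F x
... | yes _   | yes _   = refl
... | no _    | no _    = refl
... | yes x≡y | no y≢x = ⊥-elim (y≢x (sym x≡y))
... | no x≢y  | yes y≡x = ⊥-elim (x≢y (sym y≡x))

ind : Bool → ℕ
ind b = if b then 1 else 0

sum-zero : ∀ {n} (t : Fin n → ℕ) → (∀ j → t j ≡ 0) → sum t ≡ 0
sum-zero {n} t t≡0 = trans (sum-cong-≗ t≡0) (sum-replicate-zero n)

sum-point : ∀ {n} (t : Fin n → ℕ) (i : Fin n) → (∀ j → i ≢ j → t j ≡ 0) → sum t ≡ t i
sum-point {suc n} t i off = begin
  sum t                       ≡⟨ sum-remove {i = i} t ⟩
  t i + sum (t ∘ punchIn i)   ≡⟨ cong (t i +_) (sum-zero _ λ j → off _ (punchInᵢ≢i i j ∘ sym)) ⟩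
  t i + 0                     ≡⟨ +-identityʳ (t i) ⟩
  t i                         ∎
  where open ≡-Reasoning

sum-select : ∀ {n} (i : Fin n) (f : Fin n → Bool → ℕ) → (∀ j → f j false ≡ 0) →
             ∑[ j < n ] f j (i == j) ≡ f i true
sum-select i f f-false = begin
  ∑[ j < _ ] f j (i == j)  ≡⟨ sum-point _ i (λ j i≢j → trans (cong (f j) (≢⇒==-false i≢j)) (f-false j)) ⟩
  f i (i == i)             ≡⟨ cong (f i) (==-refl i) ⟩
  f i true                 ∎
  where open ≡-Reasoning

sum-ones : ∀ n → ∑[ j < n ] 1 ≡ n
sum-ones zero    = refl
sum-ones (suc n) = cong suc (sum-ones n)

count-≢ : ∀ {n} (i : Fin (suc n)) → ∑[ j < suc n ] ind (not (i == j)) ≡ n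
count-≢ {n} i = begin
  ∑[ j < suc n ] ind (not (i == j))                ≡⟨ sum-remove {i = i} (λ j → ind (not (i == j))) ⟩
  ind (not (i == i)) + ∑[ j < n ] ind (not (i == punchIn i j))
    ≡⟨ cong₂ _+_ (cong (ind ∘ not) (==-refl i))
                 (sum-cong-≗ λ j → cong (ind ∘ not) (≢⇒==-false (punchInᵢ≢i i j ∘ sym))) ⟩
  ∑[ j < n ] 1                                      ≡⟨ sum-ones n ⟩
  n                                                 ∎
  where open ≡-Reasoning

count-<ᵇ : ∀ {r i} → i ≤ r → ∑[ j < r ] ind (toℕ j <ᵇ i) ≡ i
count-<ᵇ {r} {zero}      _         = sum-zero {r} _ λ _ → refl
count-<ᵇ {suc r} {suc i} (s≤s i≤r) = cong suc (count-<ᵇ i≤r)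

sum-↑ : ∀ m {n} (t : Fin (m + n) → ℕ) → sum t ≡ ∑[ i < m ] t (i ↑ˡ n) + ∑[ j < n ] t (m ↑ʳ j)
sum-↑ zero    t = refl
sum-↑ (suc m) t = trans (cong (t zero +_) (sum-↑ m (t ∘ suc))) (sym (+-assoc (t zero) _ _))

sum-combine : ∀ m {n} (t : Fin (m * n) → ℕ) → sum t ≡ ∑[ i < m ] ∑[ j < n ] t (combine i j)
sum-combine zero        t = refl
sum-combine (suc m) {n} t =
  trans (sum-↑ n t) (cong (∑[ j < n ] t (j ↑ˡ m * n) +_) (sum-combine m (t ∘ (n ↑ʳ_))))

sum-remQuot : ∀ m {n} (f : Fin m → Fin n → ℕ) →
              ∑[ w < m * n ] f (quotient n w) (remainder {m} n w) ≡ ∑[ i < m ] ∑[ j < n ] f i j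
sum-remQuot m f = trans (sum-combine m _)
  (sum-cong-≗ λ i → sum-cong-≗ λ j → cong (uncurry f) (remQuot-combine i j))

count-filter : ∀ {A : Set} {n} (P : A → Bool) (f : Fin n → A) →
               length (filter (λ x → P x ≟B true) (tabulate f)) ≡ ∑[ i < n ] ind (P (f i))
count-filter {n = zero}  P f = refl
count-filter {n = suc n} P f with P (f zero)
... | true  = cong suc (count-filter P (f ∘ suc))
... | false = count-filter P (f ∘ suc)

degIn≡sum : ∀ {n} (G : Graph n) (S : VSet n) v → degIn G S v ≡ ∑[ w < n ] ind (adj G v w ∧ S w)
degIn≡sum G S v = count-filter (λ w → adj G v w ∧ S w) (λ w → w)

IsRegular : ∀ {n} → Graph n → ℕ → Set
IsRegular G d = ∀ v → degIn G (λ _ → true) v ≡ d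

IsRegularSet : ∀ {n} → Graph n → VSet n → ℕ → ℕ → Set
IsRegularSet G S a b = ∀ v → (T (S v) → degIn G S v ≡ a) × (¬ T (S v) → degIn G S v ≡ b)

complete : ∀ n → Graph n
complete n = record
  { adj    = λ x y → not (x == y)
  ; sym    = λ x y → cong not (==-sym x y)
  ; irrefl = λ x → cong not (==-refl x)
  }

complete-regular : ∀ n → IsRegular (complete (suc n)) n
complete-regular n x = begin
  degIn (complete (suc n)) (λ _ → true) x      ≡⟨ degIn≡sum (complete (suc n)) _ x ⟩
  ∑[ y < suc n ] ind (not (x == y) ∧ true)    ≡⟨ sum-cong-≗ (λ y → cong ind (∧-identityʳ (not (x == y)))) ⟩
  ∑[ y < suc n ] ind (not (x == y))           ≡⟨ count-≢ x ⟩
  n                                            ∎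
  where open ≡-Reasoning

copies : ∀ r {m} → Graph m → Graph (r * m)
copies r {m} H = record
  { adj    = λ v w → (block v == block w) ∧ adj H (pos v) (pos w)
  ; sym    = λ v w → cong₂ _∧_ (==-sym (block v) (block w)) (Graph.sym H (pos v) (pos w))
  ; irrefl = λ v → trans (cong (_∧ adj H (pos v) (pos v)) (==-refl (block v))) (irrefl H (pos v))
  }
  where
  block = quotient {r} m
  pos   = remainder {r} m

degIn-copies : ∀ r {m} (H : Graph m) (S : Fin r → VSet m) v →
               degIn (copies r H) (λ w → S (quotient m w) (remainder {r} m w)) v
               ≡ degIn H (S (quotient m v)) (remainder {r} m v)
degIn-copies r {m} H S v = begin
  degIn (copies r H) _ v
    ≡⟨ trans (degIn≡sum (copies r H) _ v) (sum-remQuot r (λ j y → ind (((j₀ == j) ∧ adj H y₀ y) ∧ S j y))) ⟩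
  ∑[ j < r ] ∑[ y < m ] ind (((j₀ == j) ∧ adj H y₀ y) ∧ S j y)
    ≡⟨ sum-select j₀ (λ j b → ∑[ y < m ] ind ((b ∧ adj H y₀ y) ∧ S j y)) (λ _ → sum-replicate-zero m) ⟩
  ∑[ y < m ] ind (adj H y₀ y ∧ S j₀ y)
    ≡⟨ degIn≡sum H (S j₀) y₀ ⟨
  degIn H (S j₀) y₀
    ∎
  where
  open ≡-Reasoning
  j₀ = quotient {r} m v
  y₀ = remainder {r} m v

copies-regular : ∀ r {m d} (H : Graph m) → IsRegular H d → IsRegular (copies r H) d
copies-regular r {m} H reg v = trans (degIn-copies r H (λ _ _ → true) v) (reg (remainder {r} m v))

copies-regularSet : ∀ r {m a b} (H : Graph m) (S : Fin r → VSet m) →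
                    (∀ j → IsRegularSet H (S j) a b) →
                    IsRegularSet (copies r H) (λ w → S (quotient m w) (remainder {r} m w)) a b
copies-regularSet r {m} H S reg v =
    (λ v∈S → trans (degIn-copies r H S v) (proj₁ regAtv v∈S))
  , (λ v∉S → trans (degIn-copies r H S v) (proj₂ regAtv v∉S))
  where regAtv = reg (quotient m v) (remainder {r} m v)

copiesᵀ : ∀ {m} → Graph m → ∀ n → Graph (m * n)
copiesᵀ {m} H n = record
  { adj    = λ v w → (pos v == pos w) ∧ adj H (block v) (block w)
  ; sym    = λ v w → cong₂ _∧_ (==-sym (pos v) (pos w)) (Graph.sym H (block v) (block w))
  ; irrefl = λ v → trans (cong (_∧ adj H (block v) (block v)) (==-refl (pos v))) (irrefl H (block v))
  }
  where
  block = quotient {m} n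
  pos   = remainder {m} n

copiesᵀ-regular : ∀ {m d} (H : Graph m) n → IsRegular H d → IsRegular (copiesᵀ H n) d
copiesᵀ-regular {m} H n reg v = begin
  degIn (copiesᵀ H n) (λ _ → true) v
    ≡⟨ trans (degIn≡sum (copiesᵀ H n) _ v) (sum-remQuot m (λ i k → ind (((k₀ == k) ∧ adj H i₀ i) ∧ true))) ⟩
  ∑[ i < m ] ∑[ k < n ] ind (((k₀ == k) ∧ adj H i₀ i) ∧ true)
    ≡⟨ sum-cong-≗ (λ i → sum-select k₀ (λ k b → ind ((b ∧ adj H i₀ i) ∧ true)) (λ _ → refl)) ⟩
  ∑[ i < m ] ind (adj H i₀ i ∧ true)
    ≡⟨ degIn≡sum H _ i₀ ⟨
  degIn H (λ _ → true) i₀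
    ≡⟨ reg i₀ ⟩
  _ ∎
  where
  open ≡-Reasoning
  i₀ = quotient {m} n v
  k₀ = remainder {m} n v

twoClass : ∀ {m} → Graph m → Graph m → Graph (2 * m)
twoClass {m} W B = record
  { adj    = λ v w → adj (layer v w) (pos v) (pos w)
  ; sym    = λ v w → trans (cong (λ b → adj (if b then W else B) (pos v) (pos w)) (==-sym (class v) (class w)))
                           (Graph.sym (layer w v) (pos v) (pos w))
  ; irrefl = λ v → trans (cong (λ b → adj (if b then W else B) (pos v) (pos v)) (==-refl (class v)))
                         (irrefl W (pos v))
  }
  where
  class = quotient {2} m
  pos   = remainder {2} m
  layer : Fin (2 * m) → Fin (2 * m) → Graph m
  layer v w = if class v == class w then W else B

inClass : ∀ {m} → Fin 2 → VSet (2 * m)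
inClass {m} t v = t == quotient m v

degIn-twoClass : ∀ {m} (W B : Graph m) t v →
                 degIn (twoClass W B) (inClass {m} t) v
                 ≡ degIn (if quotient m v == t then W else B) (λ _ → true) (remainder {2} m v)
degIn-twoClass {m} W B t v = begin
  degIn (twoClass W B) (inClass {m} t) v
    ≡⟨ trans (degIn≡sum (twoClass W B) _ v) (sum-remQuot 2 (λ c y → ind (adj (layer c) y₀ y ∧ (t == c)))) ⟩
  ∑[ c < 2 ] ∑[ y < m ] ind (adj (layer c) y₀ y ∧ (t == c))
    ≡⟨ sum-select t (λ c b → ∑[ y < m ] ind (adj (layer c) y₀ y ∧ b))
                    (λ c → sum-zero _ λ y → cong ind (∧-zeroʳ (adj (layer c) y₀ y))) ⟩
  ∑[ y < m ] ind (adj (layer t) y₀ y ∧ true)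
    ≡⟨ degIn≡sum (layer t) _ y₀ ⟨
  degIn (layer t) (λ _ → true) y₀
    ∎
  where
  open ≡-Reasoning
  y₀ = remainder {2} m v
  layer : Fin 2 → Graph m
  layer c = if quotient m v == c then W else B

twoClass-regularSet : ∀ {m a b} (W B : Graph m) → IsRegular W a → IsRegular B b →
                      ∀ t → IsRegularSet (twoClass W B) (inClass {m} t) a b
twoClass-regularSet {m} W B regW regB t v =
    (λ v∈S → trans (layer-is (trans (cong (c₀ ==_) (toWitness v∈S)) (==-refl c₀))) (regW y₀))
  , (λ v∉S → trans (layer-is (≢⇒==-false (λ c₀≡t → v∉S (fromWitness (sym c₀≡t))))) (regB y₀))
  where
  c₀ = quotient {2} m v
  y₀ = remainder {2} m v
  layer-is : ∀ {b} → (c₀ == t) ≡ b →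
             degIn (twoClass W B) (inClass {m} t) v ≡ degIn (if b then W else B) (λ _ → true) y₀
  layer-is c₀==t =
    trans (degIn-twoClass W B t v) (cong (λ b → degIn (if b then W else B) (λ _ → true) y₀) c₀==t)

apex : ∀ {n} → Graph n → VSet n → Graph (suc n)
apex {n} H A = record { adj = link ; sym = link-sym ; irrefl = link-irrefl }
  where
  link : Fin (suc n) → Fin (suc n) → Bool
  link zero    zero    = false
  link zero    (suc w) = A w
  link (suc v) zero    = A v
  link (suc v) (suc w) = adj H v w

  link-sym : ∀ v w → link v w ≡ link w v
  link-sym zero    zero    = refl
  link-sym zero    (suc w) = refl
  link-sym (suc v) zero    = refl
  link-sym (suc v) (suc w) = Graph.sym H v w

  link-irrefl : ∀ v → link v v ≡ false
  link-irrefl zero    = refl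
  link-irrefl (suc v) = irrefl H v

degIn-apex-zero : ∀ {n} (H : Graph n) A S → degIn (apex H A) (false ∷ S) zero ≡ ∑[ w < n ] ind (A w ∧ S w)
degIn-apex-zero H A S = degIn≡sum (apex H A) (false ∷ S) zero

degIn-apex-suc : ∀ {n} (H : Graph n) A S v → degIn (apex H A) (false ∷ S) (suc v) ≡ degIn H S v
degIn-apex-suc {n} H A S v = begin
  degIn (apex H A) (false ∷ S) (suc v)                   ≡⟨ degIn≡sum (apex H A) (false ∷ S) (suc v) ⟩
  ind (A v ∧ false) + ∑[ w < n ] ind (adj H v w ∧ S w)   ≡⟨ cong (λ b → ind b + _) (∧-zeroʳ (A v)) ⟩
  ∑[ w < n ] ind (adj H v w ∧ S w)                       ≡⟨ degIn≡sum H S v ⟨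
  degIn H S v                                            ∎
  where open ≡-Reasoning

apex-partialSolution : ∀ {σ ρ n a b} (H : Graph n) A S → IsRegularSet H S a b → a ∈S σ → b ∈S ρ →
                       IsPartialSolution σ ρ (apex H A) (single zero) (false ∷ S)
apex-partialSolution H A S reg a∈σ b∈ρ zero    notPortal = ⊥-elim (notPortal tt)
apex-partialSolution H A S reg a∈σ b∈ρ (suc v) _ =
    (λ v∉S → subst (_∈S _) (sym (trans (degIn-apex-suc H A S v) (proj₂ (reg v) v∉S))) b∈ρ)
  , (λ v∈S → subst (_∈S _) (sym (trans (degIn-apex-suc H A S v) (proj₁ (reg v) v∈S))) a∈σ)

gadget : ∀ s p → Graph (2 * (suc s * suc p))
gadget s p = twoClass (copiesᵀ (complete (suc s)) (suc p)) (copies (suc s) (complete (suc p)))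

gadget-regularSet : ∀ s p t → IsRegularSet (gadget s p) (inClass {suc s * suc p} t) s p
gadget-regularSet s p = twoClass-regularSet _ _
  (copiesᵀ-regular (complete (suc s)) (suc p) (complete-regular s))
  (copies-regular (suc s) (complete (suc p)) (complete-regular p))

module _ (s p : ℕ) where

  cells : ℕ
  cells = suc s * suc p

  gadgets : ℕ → ℕ
  gadgets r = r * (2 * cells)

  provider : ∀ r → Graph (suc (gadgets r))
  provider r = apex (copies r (gadget s p)) (λ w → zero == remainder {r} _ w)

  selectedClass : ℕ → ∀ {r} → Fin r → Fin 2
  selectedClass i j = if toℕ j <ᵇ i then zero else suc zero

  selection : ∀ r → ℕ → VSet (suc (gadgets r))
  selection r i =
    false ∷ λ w → inClass {cells} (selectedClass i (quotient {r} (2 * cells) w)) (remainder {r} _ w)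

  hub-selected : ∀ i {r} (j : Fin r) → inClass {cells} (selectedClass i j) zero ≡ (toℕ j <ᵇ i)
  hub-selected i j with toℕ j <ᵇ i
  ... | true  = refl
  ... | false = refl

  selection-portal-degree : ∀ {r i} → i ≤ r → degIn (provider r) (selection r i) zero ≡ i
  selection-portal-degree {r} {i} i≤r = begin
    degIn (provider r) (selection r i) zero
      ≡⟨ trans (degIn-apex-zero (copies r (gadget s p)) _ _)
               (sum-remQuot r (λ j y → ind ((zero == y) ∧ selected j y))) ⟩
    ∑[ j < r ] ∑[ y < 2 * cells ] ind ((zero == y) ∧ selected j y)
      ≡⟨ sum-cong-≗ (λ j → sum-select zero (λ y b → ind (b ∧ selected j y)) (λ _ → refl)) ⟩
    ∑[ j < r ] ind (selected j zero)
      ≡⟨ sum-cong-≗ (λ (j : Fin r) → cong ind (hub-selected i j)) ⟩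
    ∑[ j < r ] ind (toℕ j <ᵇ i)
      ≡⟨ count-<ᵇ i≤r ⟩
    i ∎
    where
    open ≡-Reasoning
    selected : Fin r → VSet (2 * cells)
    selected j = inClass {cells} (selectedClass i j)

  provider-isProvider : ∀ {σ ρ} → s ∈S σ → p ∈S ρ → ∀ r →
                        IsProvider σ ρ (provider r) (single zero) (RhoUpTo zero r)
  provider-isProvider {σ} {ρ} s∈σ p∈ρ r x (i , i≤r , x₀≡ρᵢ) = selection r i , partial , compatible
    where
    partial : IsPartialSolution σ ρ (provider r) (single zero) (selection r i)
    partial = apex-partialSolution _ _ _
      (copies-regularSet r (gadget s p) _ (λ j → gadget-regularSet s p (selectedClass i j))) s∈σ p∈ρ

    compatible : ∀ v → T (single zero v) → x v ≡ stateOf (provider r) (selection r i) v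
    compatible zero    _ = trans x₀≡ρᵢ (cong ρ′ (sym (selection-portal-degree i≤r)))
    compatible (suc v) ()

lemma7p3 : (σ ρ : FinCof) → NonEmpty σ → NonEmpty ρ →
    ∃ λ n → Σ (Graph n) λ G → Σ (Fin n) λ u →
      IsProvider σ ρ G (single u) (RhoUpTo u (rtop ρ))
lemma7p3 σ ρ (s , s∈σ) (p , p∈ρ) =
  _ , provider s p (rtop ρ) , zero , provider-isProvider s p s∈σ p∈ρ (rtop ρ)
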